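{- Let $S$ be a string, $k$ a positive integer, $A,B$ strings and $\sigma$ a character. Then $A\sigma B$ is a $k$-repeating subsequence of $S$ if and only if there exists a $\sigma$-split point for $A$ and $B$.
   Context: For a string $S$, $S[i,j]=S[i]\cdots S[j]$ (empty if $j<i$), $S[i,j)=S[i,j-1]$, $S(i,j]=S[i+1,j]$. A string $X$ is a $k$-repeating subsequence of $S$ if $X^k$ (the concatenation of $k$ copies of $X$) is a subsequence of $S$. For a string $X$ and an index $i\in[1,|S|]$, $\mathrm{next}(S,X,i)$ is the smallest $j\ge i$ such that $X$ is a subsequence of $S(i,j]$, and is Null if $X$ is not a subsequence of $S(i,|S|]$; $\mathrm{prev}(S,X,i)$ is the largest $l\le i$ such that $X$ is a subsequence of $S[l,i)$, and is Null if $X$ is not a subsequence of $S[1,i)$. A $\sigma$-split point for $A$ and $B$ is a tuple $p=(p_1,\dots,p_k)\in[1,|S|]^k$ such that $S[p_i]=\sigma$ for all $i$, $\mathrm{next}(S,B,p_i)$ and $\mathrm{prev}(S,A,p_i)$ are not Null for all $i\in[1,k]$, and $\mathrm{next}(S,B,p_i)<\mathrm{prev}(S,A,p_{i+1})$ for all $i\in[1,k-1]$. -}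

module Defs where

open import Data.Nat using (ℕ; zero; suc; _≤_; _<_; _∸_)
open import Data.Fin using (Fin; toℕ)
open import Data.List using (List; []; _∷_; _++_; take; drop; length; concat; replicate)
open import Data.List.Relation.Binary.Sublist.Propositional using (_⊆_)
open import Data.Maybe using (Maybe; just; nothing)
open import Data.Product using (_×_; ∃)
open import Relation.Binary.PropositionalEquality using (_≡_)

-- Strings over an alphabet C are lists; positions are 1-indexed.
-- "X is a subsequence of S" is the stdlib sublist relation X ⊆ S.

charAt : {C : Set} → List C → ℕ → Maybe C
charAt []       _             = nothing
charAt (x ∷ xs) zero          = nothing
charAt (x ∷ xs) (suc zero)    = just x
charAt (x ∷ xs) (suc (suc n)) = charAt xs (suc n)

-- S(i,j] = S[i+1] ... S[j]
sub-oc : {C : Set} → List C → ℕ → ℕ → List C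
sub-oc S i j = drop i (take j S)

-- S[l,i) = S[l] ... S[i-1]   (for l ≥ 1)
sub-co : {C : Set} → List C → ℕ → ℕ → List C
sub-co S l i = drop (l ∸ 1) (take (i ∸ 1) S)

power : {C : Set} → List C → ℕ → List C
power X k = concat (replicate k X)

KRepeating : {C : Set} → ℕ → List C → List C → Set
KRepeating k X S = power X k ⊆ S

-- next(S,X,i) = j  (j is the smallest j ≥ i with X a subsequence of S(i,j]);
-- next(S,X,i) is non-Null iff some j satisfies IsNext S X i j (such j is unique).
IsNext : {C : Set} → List C → List C → ℕ → ℕ → Set
IsNext S X i j =
  i ≤ j × j ≤ length S × X ⊆ sub-oc S i j ×
  (∀ j′ → i ≤ j′ → j′ ≤ length S → X ⊆ sub-oc S i j′ → j ≤ j′)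

IsPrev : {C : Set} → List C → List C → ℕ → ℕ → Set
IsPrev S X i l =
  1 ≤ l × l ≤ i × X ⊆ sub-co S l i ×
  (∀ l′ → 1 ≤ l′ → l′ ≤ i → X ⊆ sub-co S l′ i → l′ ≤ l)

SplitPoint : {C : Set} → (S : List C) (k : ℕ) (σ : C) (A B : List C) → (Fin k → ℕ) → Set
SplitPoint S k σ A B p =
  (∀ i → 1 ≤ p i × p i ≤ length S × charAt S (p i) ≡ just σ) ×
  (∀ i → ∃ λ j → IsNext S B (p i) j) ×
  (∀ i → ∃ λ l → IsPrev S A (p i) l) ×
  (∀ (i i′ : Fin k) → toℕ i′ ≡ suc (toℕ i) →
     ∀ j l → IsNext S B (p i) j → IsPrev S A (p i′) l → j < l)

{-# OPTIONS --safe #-}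
-- Embeddings of Xᵏ into S correspond to k ordered, non-overlapping windows (aᵢ, bᵢ] of S, each
-- containing X = A σ B. Splitting the embedding in a window at the σ it uses gives a position pᵢ
-- with A ⊆ S(aᵢ, pᵢ − 1] and B ⊆ S(pᵢ, bᵢ]; by the extremality of next and prev,
-- next(S, B, pᵢ) ≤ bᵢ ≤ aᵢ₊₁ < prev(S, A, pᵢ₊₁). Conversely a split point yields the windows
-- (prev(S, A, pᵢ) − 1, next(S, B, pᵢ)], which the split-point condition keeps ordered.
-- Decidable equality is needed only to obtain next and prev as least and greatest witnesses.
module Submission where

open import Defs
open import Data.Nat using (ℕ; zero; suc; pred; _<_; _≤_; _≤?_; z≤n; s≤s; s≤s⁻¹)
open import Data.Nat.Properties
  using (≤-refl; ≤-trans; <-≤-trans; ≤-<-trans; <⇒≤; ≮⇒≥; ≤∧≢⇒<; n≤1+n; suc-injective;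
         suc[m]≤n⇒m≤pred[n]; anyUpTo?)
open import Data.Nat.Induction using (<-rec)
open import Data.Fin using (Fin; toℕ; zero; suc)
import Data.Vec.Functional as Vector
open import Data.List using (List; []; _∷_; _++_; take; length)
open import Data.List.Properties using (take-all)
open import Data.List.Relation.Binary.Sublist.Propositional
  using (_⊆_; []; _∷_; _∷ʳ_; ⊆-trans; ⊆-reflexive; minimum)
open import Data.List.Relation.Binary.Sublist.Propositional.Properties
  using (++⁺; take⁺; drop⁺; take-⊆; drop-⊆)
import Data.List.Relation.Binary.Sublist.DecPropositional as DecSublist
open import Data.Maybe using (just)
open import Data.Product using (∃; ∃₂; _×_; _,_; proj₁; proj₂)
open import Function using (_∘_)
open import Function.Bundles using (_⇔_; mk⇔)
open import Relation.Nullary using (yes; no)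
open import Relation.Nullary.Decidable using (_×-dec_)
open import Relation.Unary using (Decidable)
open import Relation.Binary.Definitions using (DecidableEquality)
open import Relation.Binary.PropositionalEquality using (_≡_; refl; sym; cong)

Least Greatest : (ℕ → Set) → ℕ → Set
Least    P m = P m × (∀ {m′} → P m′ → m ≤ m′)
Greatest P m = P m × (∀ {m′} → P m′ → m′ ≤ m)

module _ {P : ℕ → Set} (P? : Decidable P) where

  least-witness : ∀ {n} → P n → ∃ (Least P)
  least-witness {n} = <-rec (λ n → P n → ∃ (Least P)) search n
    where
    search : ∀ n → (∀ {m} → m < n → P m → ∃ (Least P)) → P n → ∃ (Least P)
    search n smaller Pn with anyUpTo? P? n
    ... | yes (m , m<n , Pm) = smaller m<n Pm
    ... | no none = n , Pn , λ Pm′ → ≮⇒≥ (λ m′<n → none (_ , m′<n , Pm′))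

  greatest-witness : ∀ N → (∀ {m} → P m → m ≤ N) → ∀ {n} → P n → ∃ (Greatest P)
  greatest-witness zero    bounded Pn = _ , Pn , λ Pm′ → ≤-trans (bounded Pm′) z≤n
  greatest-witness (suc N) bounded Pn with P? (suc N)
  ... | yes PN = suc N , PN , bounded
  ... | no ¬PN = greatest-witness N (λ Pm → s≤s⁻¹ (≤∧≢⇒< (bounded Pm) (λ { refl → ¬PN Pm }))) Pn

module _ {C : Set} where

  sub-oc-mono : (S : List C) {a′ a b b′ : ℕ} → a′ ≤ a → b ≤ b′ → sub-oc S a b ⊆ sub-oc S a′ b′
  sub-oc-mono S a′≤a b≤b′ = drop⁺ a′≤a (take⁺ b≤b′)

  sub-oc-⊆ : (S : List C) (a c : ℕ) → sub-oc S a c ⊆ S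
  sub-oc-⊆ S a c = ⊆-trans (drop-⊆ a (take c S)) (take-⊆ c S)

  ⊆-sub-oc-length : (S : List C) → S ⊆ sub-oc S 0 (length S)
  ⊆-sub-oc-length S = ⊆-reflexive (sym (take-all (length S) S ≤-refl))

  sub-oc-++ : (S : List C) {a b c : ℕ} → a ≤ b → b ≤ c → sub-oc S a b ++ sub-oc S b c ≡ sub-oc S a c
  sub-oc-++ S       {b = zero}  z≤n _           = refl
  sub-oc-++ []      {b = suc b} z≤n (s≤s _)     = refl
  sub-oc-++ (x ∷ S) {b = suc b} z≤n (s≤s b≤c)   = cong (x ∷_) (sub-oc-++ S z≤n b≤c)
  sub-oc-++ []      (s≤s _)     (s≤s _)         = refl
  sub-oc-++ (x ∷ S) (s≤s a≤b)   (s≤s b≤c)       = sub-oc-++ S a≤b b≤c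

  ++-sub-oc⁺ : (S : List C) {X Y : List C} {a b c : ℕ} → a ≤ b → b ≤ c →
               X ⊆ sub-oc S a b → Y ⊆ sub-oc S b c → X ++ Y ⊆ sub-oc S a c
  ++-sub-oc⁺ S a≤b b≤c X⊆ Y⊆ = ⊆-trans (++⁺ X⊆ Y⊆) (⊆-reflexive (sub-oc-++ S a≤b b≤c))

  ++-sub-oc⁻ : (S X : List C) {Y : List C} {a c : ℕ} → a ≤ c → X ++ Y ⊆ sub-oc S a c →
               ∃ λ b → a ≤ b × b ≤ c × X ⊆ sub-oc S a b × Y ⊆ sub-oc S b c
  ++-sub-oc⁻ S       []      z≤n       Y⊆           = 0 , z≤n , z≤n , [] , Y⊆
  ++-sub-oc⁻ (s ∷ S) (x ∷ X) {c = suc c} z≤n (.s ∷ʳ XY⊆) with ++-sub-oc⁻ S (x ∷ X) z≤n XY⊆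
  ... | b , _ , b≤c , X⊆ , Y⊆ = suc b , z≤n , s≤s b≤c , s ∷ʳ X⊆ , Y⊆
  ++-sub-oc⁻ (s ∷ S) (x ∷ X) {c = suc c} z≤n (x≡s ∷ XY⊆) with ++-sub-oc⁻ S X z≤n XY⊆
  ... | b , _ , b≤c , X⊆ , Y⊆ = suc b , z≤n , s≤s b≤c , x≡s ∷ X⊆ , Y⊆
  ++-sub-oc⁻ []      []      (s≤s a≤c) []           = _ , ≤-refl , s≤s a≤c , [] , []
  ++-sub-oc⁻ (s ∷ S) X       (s≤s a≤c) XY⊆ with ++-sub-oc⁻ S X a≤c XY⊆
  ... | b , a≤b , b≤c , X⊆ , Y⊆ = suc b , s≤s a≤b , s≤s b≤c , X⊆ , Y⊆

  ∷-sub-oc⁻ : (S : List C) {x : C} {X : List C} (a b : ℕ) → x ∷ X ⊆ sub-oc S a b →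
              ∃ λ q → a ≤ q × q < b × charAt S (suc q) ≡ just x × X ⊆ sub-oc S (suc q) b
  ∷-sub-oc⁻ (s ∷ S) zero    (suc b) (.s ∷ʳ xX⊆) with ∷-sub-oc⁻ S zero b xX⊆
  ... | q , _ , q<b , S[q]≡x , X⊆ = suc q , z≤n , s≤s q<b , S[q]≡x , X⊆
  ∷-sub-oc⁻ (s ∷ S) zero    (suc b) (refl ∷ X⊆) = zero , z≤n , s≤s z≤n , refl , X⊆
  ∷-sub-oc⁻ (s ∷ S) (suc a) (suc b) xX⊆ with ∷-sub-oc⁻ S a b xX⊆
  ... | q , a≤q , q<b , S[q]≡x , X⊆ = suc q , s≤s a≤q , s≤s q<b , S[q]≡x , X⊆

  charAt-sub-oc : (S : List C) {x : C} (q : ℕ) → charAt S (suc q) ≡ just x → x ∷ [] ⊆ sub-oc S q (suc q)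
  charAt-sub-oc (s ∷ S) zero    refl    = refl ∷ []
  charAt-sub-oc (s ∷ S) (suc q) S[q]≡x = charAt-sub-oc S q S[q]≡x

  record CharSplit (S : List C) (x : C) (A B : List C) (a b : ℕ) : Set where
    field
      p      : ℕ
      a<p    : a < p
      p≤b    : p ≤ b
      S[p]≡x : charAt S p ≡ just x
      A⊆     : A ⊆ sub-co S (suc a) p
      B⊆     : B ⊆ sub-oc S p b

    a≤b : a ≤ b
    a≤b = <⇒≤ (<-≤-trans a<p p≤b)

    next≤b : b ≤ length S → ∀ {j} → IsNext S B p j → j ≤ b
    next≤b b≤|S| (_ , _ , _ , least) = least b p≤b b≤|S| B⊆

    a<prev : ∀ {l} → IsPrev S A p l → a < l
    a<prev (_ , _ , _ , greatest) = greatest (suc a) (s≤s z≤n) a<p A⊆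

  split-at-char : (S : List C) {x : C} {A B : List C} {a b : ℕ} → a ≤ b →
                  A ++ x ∷ B ⊆ sub-oc S a b → CharSplit S x A B a b
  split-at-char S {A = A} {a = a} {b = b} a≤b AxB⊆ with ++-sub-oc⁻ S A a≤b AxB⊆
  ... | m , a≤m , m≤b , A⊆ , xB⊆ with ∷-sub-oc⁻ S m b xB⊆
  ... | q , m≤q , q<b , S[q]≡x , B⊆ = record
    { p = suc q ; a<p = s≤s (≤-trans a≤m m≤q) ; p≤b = q<b ; S[p]≡x = S[q]≡x
    ; A⊆ = ⊆-trans A⊆ (sub-oc-mono S {a} ≤-refl m≤q) ; B⊆ = B⊆ }

  join-at-char : (S : List C) {x : C} {A B : List C} {a b : ℕ} →
                 CharSplit S x A B a b → A ++ x ∷ B ⊆ sub-oc S a b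
  join-at-char S record { p = suc q ; a<p = s≤s a≤q ; p≤b = q<b ; S[p]≡x = S[q]≡x ; A⊆ = A⊆ ; B⊆ = B⊆ } =
    ++-sub-oc⁺ S a≤q (<⇒≤ q<b) A⊆ (++-sub-oc⁺ S (n≤1+n q) q<b (charAt-sub-oc S q S[q]≡x) B⊆)

  prev∧next⇒CharSplit : {S : List C} {x : C} {A B : List C} {p l j : ℕ} →
                        charAt S p ≡ just x → IsPrev S A p l → IsNext S B p j → CharSplit S x A B (pred l) j
  prev∧next⇒CharSplit S[p]≡x (s≤s z≤n , l≤p , A⊆ , _) (p≤j , _ , B⊆ , _) = record
    { p = _ ; a<p = l≤p ; p≤b = p≤j ; S[p]≡x = S[p]≡x ; A⊆ = A⊆ ; B⊆ = B⊆ }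

  record Windows (S X : List C) (c : ℕ) {k : ℕ} (a b : Fin k → ℕ) : Set where
    field
      a≤b     : ∀ i → a i ≤ b i
      b≤c     : ∀ i → b i ≤ c
      X⊆      : ∀ i → X ⊆ sub-oc S (a i) (b i)
      ordered : ∀ i i′ → toℕ i′ ≡ suc (toℕ i) → b i ≤ a i′

  -- The bound a₀ ≤ aᵢ is only an induction invariant: it puts the new window (a₀, m] before the tail.
  power-⊆⇒windows : (S X : List C) (k : ℕ) {a₀ c : ℕ} → a₀ ≤ c → power X k ⊆ sub-oc S a₀ c →
                    ∃₂ λ (a b : Fin k → ℕ) → (∀ i → a₀ ≤ a i) × Windows S X c a b
  power-⊆⇒windows S X zero    _    _ = (λ ()) , (λ ()) , (λ ()) , record
    { a≤b = λ () ; b≤c = λ () ; X⊆ = λ () ; ordered = λ () }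
  power-⊆⇒windows S X (suc k) {a₀} a₀≤c Xᵏ⁺¹⊆ with ++-sub-oc⁻ S X a₀≤c Xᵏ⁺¹⊆
  ... | m , a₀≤m , m≤c , X⊆ , Xᵏ⊆ with power-⊆⇒windows S X k m≤c Xᵏ⊆
  ... | a , b , m≤a , windows = a₀ Vector.∷ a , m Vector.∷ b , a₀≤ , record
    { a≤b = λ { zero → a₀≤m ; (suc i) → W.a≤b i }
    ; b≤c = λ { zero → m≤c ; (suc i) → W.b≤c i }
    ; X⊆ = λ { zero → X⊆ ; (suc i) → W.X⊆ i }
    ; ordered = ordered }
    where
    module W = Windows windows
    a₀≤ : ∀ i → a₀ ≤ (a₀ Vector.∷ a) i
    a₀≤ zero    = ≤-refl
    a₀≤ (suc i) = ≤-trans a₀≤m (m≤a i)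
    ordered : ∀ i i′ → toℕ i′ ≡ suc (toℕ i) → (m Vector.∷ b) i ≤ (a₀ Vector.∷ a) i′
    ordered zero    (suc i′) _  = m≤a i′
    ordered (suc i) (suc i′) eq = W.ordered i i′ (suc-injective eq)

  windows⇒power-⊆ : (S X : List C) {n c : ℕ} {a b : Fin (suc n) → ℕ} →
                    Windows S X c a b → power X (suc n) ⊆ sub-oc S (a zero) c
  windows⇒power-⊆ S X {zero} windows =
    ++-sub-oc⁺ S (W.a≤b zero) (W.b≤c zero) (W.X⊆ zero) (minimum _)
    where module W = Windows windows
  windows⇒power-⊆ S X {suc n} {c} {a} {b} windows =
    ++-sub-oc⁺ S (W.a≤b zero) (W.b≤c zero) (W.X⊆ zero)
      (⊆-trans (windows⇒power-⊆ S X tail) (sub-oc-mono S (W.ordered zero (suc zero) refl) ≤-refl))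
    where
    module W = Windows windows
    tail : Windows S X c (a ∘ suc) (b ∘ suc)
    tail = record
      { a≤b = W.a≤b ∘ suc ; b≤c = W.b≤c ∘ suc ; X⊆ = W.X⊆ ∘ suc
      ; ordered = λ i i′ eq → W.ordered (suc i) (suc i′) (cong suc eq) }

  split-point⇒windows : (S : List C) {k : ℕ} {σ : C} {A B : List C} {p : Fin k → ℕ} →
                        SplitPoint S k σ A B p →
                        ∃₂ λ (a b : Fin k → ℕ) → Windows S (A ++ σ ∷ B) (length S) a b
  split-point⇒windows S {k} {σ} {A} {B} (position , next , prev , separated) = pred ∘ l , j , record
    { a≤b = CharSplit.a≤b ∘ split
    ; b≤c = j≤length
    ; X⊆ = join-at-char S ∘ split
    ; ordered = λ i i′ eq →
        suc[m]≤n⇒m≤pred[n] (separated i i′ eq (j i) (l i′) (proj₂ (next i)) (proj₂ (prev i′))) }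
    where
    j l : Fin k → ℕ
    j = proj₁ ∘ next
    l = proj₁ ∘ prev
    j≤length : ∀ i → j i ≤ length S
    j≤length i with proj₂ (next i)
    ... | _ , j≤|S| , _ = j≤|S|
    split : ∀ i → CharSplit S σ A B (pred (l i)) (j i)
    split i = prev∧next⇒CharSplit (proj₂ (proj₂ (position i))) (proj₂ (prev i)) (proj₂ (next i))

  module _ (_≟_ : DecidableEquality C) where
    open DecSublist _≟_ using (_⊆?_)

    next-exists : (S X : List C) {i j : ℕ} → i ≤ j → j ≤ length S → X ⊆ sub-oc S i j → ∃ (IsNext S X i)
    next-exists S X {i} i≤j j≤|S| X⊆
      with least-witness (λ j → (i ≤? j) ×-dec ((j ≤? length S) ×-dec (X ⊆? sub-oc S i j)))
             (i≤j , j≤|S| , X⊆)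
    ... | j , (i≤j , j≤|S| , X⊆) , least =
      j , i≤j , j≤|S| , X⊆ , λ j′ i≤j′ j′≤|S| X⊆′ → least (i≤j′ , j′≤|S| , X⊆′)

    prev-exists : (S X : List C) {i l : ℕ} → 1 ≤ l → l ≤ i → X ⊆ sub-co S l i → ∃ (IsPrev S X i)
    prev-exists S X {i} 1≤l l≤i X⊆
      with greatest-witness (λ l → (1 ≤? l) ×-dec ((l ≤? i) ×-dec (X ⊆? sub-co S l i))) i (proj₁ ∘ proj₂)
             (1≤l , l≤i , X⊆)
    ... | l , (1≤l , l≤i , X⊆) , greatest =
      l , 1≤l , l≤i , X⊆ , λ l′ 1≤l′ l′≤i X⊆′ → greatest (1≤l′ , l′≤i , X⊆′)

    windows⇒split-point : (S : List C) {k : ℕ} {σ : C} {A B : List C} {a b : Fin k → ℕ} →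
                          Windows S (A ++ σ ∷ B) (length S) a b → ∃ (SplitPoint S k σ A B)
    windows⇒split-point S {k} {σ} {A} {B} {a} {b} windows = Split.p , position , next , prev , separated
      where
      module W = Windows windows
      split : ∀ i → CharSplit S σ A B (a i) (b i)
      split i = split-at-char S (W.a≤b i) (W.X⊆ i)
      module Split i = CharSplit (split i)
      position : ∀ i → 1 ≤ Split.p i × Split.p i ≤ length S × charAt S (Split.p i) ≡ just σ
      position i = ≤-trans (s≤s z≤n) (Split.a<p i) , ≤-trans (Split.p≤b i) (W.b≤c i) , Split.S[p]≡x i
      next : ∀ i → ∃ (IsNext S B (Split.p i))
      next i = next-exists S B (Split.p≤b i) (W.b≤c i) (Split.B⊆ i)
      prev : ∀ i → ∃ (IsPrev S A (Split.p i))
      prev i = prev-exists S A (s≤s z≤n) (Split.a<p i) (Split.A⊆ i)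
      separated : ∀ i i′ → toℕ i′ ≡ suc (toℕ i) →
                  ∀ j l → IsNext S B (Split.p i) j → IsPrev S A (Split.p i′) l → j < l
      separated i i′ eq j l isNext isPrev =
        ≤-<-trans (≤-trans (Split.next≤b i (W.b≤c i) isNext) (W.ordered i i′ eq)) (Split.a<prev i′ isPrev)

lemma8 : {C : Set} → DecidableEquality C →
    (S : List C) (k : ℕ) → 0 < k → (A B : List C) (σ : C) →
    KRepeating k (A ++ σ ∷ B) S ⇔ (∃ λ (p : Fin k → ℕ) → SplitPoint S k σ A B p)
lemma8 _   S zero    () A B σ
lemma8 _≟_ S (suc k) _  A B σ = mk⇔ splitting joining
  where
  splitting : KRepeating (suc k) (A ++ σ ∷ B) S → ∃ (SplitPoint S (suc k) σ A B)
  splitting repeating with power-⊆⇒windows S (A ++ σ ∷ B) (suc k) z≤n (⊆-trans repeating (⊆-sub-oc-length S))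
  ... | _ , _ , _ , windows = windows⇒split-point _≟_ S windows
  joining : ∃ (SplitPoint S (suc k) σ A B) → KRepeating (suc k) (A ++ σ ∷ B) S
  joining (_ , split-point) with split-point⇒windows S split-point
  ... | a , _ , windows = ⊆-trans (windows⇒power-⊆ S (A ++ σ ∷ B) windows) (sub-oc-⊆ S (a zero) (length S))
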